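{- For every permutation $\sigma=\sigma_1\cdots\sigma_n\in\mathfrak{S}_n$, $$\mathrm{inv}(\sigma)-\mathrm{inv}(\Phi_{321}(\sigma))=\#\{(j,k):\ 1\le j<k\le n,\ \exists\, i<j \text{ with } \sigma_i>\sigma_j>\sigma_k\}.$$
   Context: $\mathrm{inv}(\sigma)=\#\{(i,j):i<j,\ \sigma_i>\sigma_j\}$. A position $i$ is a left-to-right maximum of $\sigma$ if $\sigma_i>\sigma_j$ for all $j<i$. The Simion–Schmidt map $\Phi_{321}:\mathfrak{S}_n\to\mathfrak{S}_n$ keeps the entries at the positions of the left-to-right maxima of $\sigma$ fixed, and places all remaining entries of $\sigma$ in increasing order into the remaining positions. -}

module Defs where

open import Data.Bool using (Bool; true; false)
open import Data.Nat using (ℕ; zero; suc; _+_; _<_; _<?_)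
open import Data.Nat.Properties using (≤-decTotalOrder)
open import Data.Fin using (Fin; toℕ)
open import Data.Fin.Properties using (any?; all?)
open import Data.List using (List; []; _∷_; length; lookup; filter; allFin; cartesianProduct; upTo; map)
open import Data.Product using (_×_; _,_; ∃)
open import Relation.Nullary using (Dec; does)
open import Relation.Nullary.Decidable using (_×-dec_; _→-dec_)
open import Relation.Binary.PropositionalEquality using (_≡_)
open import Data.List.Relation.Binary.Permutation.Propositional using (_↭_)
open import Data.List.Sort ≤-decTotalOrder using (sort)

IsPerm : ℕ → List ℕ → Set
IsPerm n σ = σ ↭ map suc (upTo n)

-- Positions are 0-indexed elements of Fin (length σ); σ at position i.
at : (σ : List ℕ) → Fin (length σ) → ℕ
at σ i = lookup σ i

Pair : List ℕ → Set
Pair σ = Fin (length σ) × Fin (length σ)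

InvPair : (σ : List ℕ) → Pair σ → Set
InvPair σ (i , j) = (toℕ i < toℕ j) × (at σ j < at σ i)

invPair? : (σ : List ℕ) → (p : Pair σ) → Dec (InvPair σ p)
invPair? σ (i , j) = (toℕ i <? toℕ j) ×-dec (at σ j <? at σ i)

allPairs : (σ : List ℕ) → List (Pair σ)
allPairs σ = cartesianProduct (allFin (length σ)) (allFin (length σ))

inv : List ℕ → ℕ
inv σ = length (filter (invPair? σ) (allPairs σ))

IsLRMax : (σ : List ℕ) → Fin (length σ) → Set
IsLRMax σ i = (j : Fin (length σ)) → toℕ j < toℕ i → at σ j < at σ i

isLRMax? : (σ : List ℕ) → (i : Fin (length σ)) → Dec (IsLRMax σ i)
isLRMax? σ i = all? (λ j → (toℕ j <? toℕ i) →-dec (at σ j <? at σ i))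

lrFlags : (σ : List ℕ) → List Bool
lrFlags σ = map (λ i → does (isLRMax? σ i)) (allFin (length σ))

nonMaxEntries : List Bool → List ℕ → List ℕ
nonMaxEntries (true ∷ bs) (x ∷ xs) = nonMaxEntries bs xs
nonMaxEntries (false ∷ bs) (x ∷ xs) = x ∷ nonMaxEntries bs xs
nonMaxEntries _ _ = []

refill : List Bool → List ℕ → List ℕ → List ℕ
refill (true ∷ bs) (x ∷ xs) ys = x ∷ refill bs xs ys
refill (false ∷ bs) (x ∷ xs) (y ∷ ys) = y ∷ refill bs xs ys
refill _ _ _ = []

Φ321 : List ℕ → List ℕ
Φ321 σ = refill (lrFlags σ) σ (sort (nonMaxEntries (lrFlags σ) σ))

RhsPair : (σ : List ℕ) → Pair σ → Set
RhsPair σ (j , k) =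
  (toℕ j < toℕ k) × (at σ k < at σ j) ×
  ∃ (λ (i : Fin (length σ)) → (toℕ i < toℕ j) × (at σ j < at σ i))

rhsPair? : (σ : List ℕ) → (p : Pair σ) → Dec (RhsPair σ p)
rhsPair? σ (j , k) =
  (toℕ j <? toℕ k) ×-dec (at σ k <? at σ j) ×-dec
  any? (λ i → (toℕ i <? toℕ j) ×-dec (at σ j <? at σ i))

rhsCount : List ℕ → ℕ
rhsCount σ = length (filter (rhsPair? σ) (allPairs σ))

{-# OPTIONS --safe #-}
module Submission where

-- Read σ from left to right, keeping the maximum m of the prefix read so far. A left-to-right
-- maximum x stays in place under Φ₃₂₁ and has equally many smaller entries after it in σ and in
-- Φ₃₂₁(σ): both suffixes consist of the same later maxima and of non-maximal values with equally
-- many entries below x. An entry x below m is dominated, so its later smaller entries are counted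
-- both in inv σ and on the right-hand side; in Φ₃₂₁(σ) its position receives the least value still
-- to be placed, which lies below every later entry and so starts no inversion. The induction
-- carries the invariant that the sorted values still to be placed agree with the remaining
-- non-maxima above m, and have equally many entries ≤ m.

open import Data.Bool using (Bool; true; false; if_then_else_)
open import Data.Fin using (Fin; zero; suc; toℕ)
open import Data.Fin.Properties using (any?)
open import Data.List using (List; []; _∷_; _++_; length; filter; tabulate; lookup; map; cartesianProduct)
open import Data.List.Membership.Propositional.Properties using (∈-lookup)
open import Data.List.Properties
  using (length-++; filter-++; filter-none; filter-accept; filter-≐; map-tabulate; tabulate-lookup; map-upTo)
open import Data.List.Relation.Binary.Permutation.Propositional
  using (_↭_; ↭-refl; ↭-sym; ↭-trans; prep; ↭⇒↭ₛ)
open import Data.List.Relation.Binary.Permutation.Propositional.Properties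
  using (All-resp-↭; ↭-length; filter-↭; shift)
open import Data.List.Relation.Unary.All as All using (All; []; _∷_)
open import Data.List.Relation.Unary.All.Properties using (++⁺)
open import Data.List.Relation.Unary.AllPairs as AllPairs using (_∷_)
import Data.List.Relation.Unary.Linked as Linked
open import Data.List.Relation.Unary.Linked.Properties using (Linked⇒All)
open import Data.List.Relation.Unary.Unique.Propositional using (Unique)
open import Data.List.Relation.Unary.Unique.Propositional.Properties using (upTo⁺)
open import Data.Nat using (ℕ; zero; suc; _+_; _≤_; _<_; _<?_; s≤s; z<s; s<s; s<s⁻¹)
open import Data.Nat.Properties
open import Data.Product using (_×_; _,_; proj₁; proj₂; ∃)
open import Data.Product.Function.NonDependent.Propositional using (_×-⇔_)
open import Data.Sum using (_⊎_; inj₁; inj₂; [_,_])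
open import Function using (_∘_; id; _⇔_; mk⇔; Equivalence)
import Function.Properties.Equivalence as ⇔
open import Relation.Binary.PropositionalEquality
  using (_≡_; refl; sym; trans; cong; cong₂; subst; ≢-sym; resp₂; setoid; module ≡-Reasoning)
open import Relation.Nullary using (Dec; does; yes; no; ¬_)
open import Relation.Nullary.Decidable using (does-⇔; dec-true; dec-false; _×-dec_; _⊎-dec_)
open import Relation.Unary using (Pred; Decidable)
open import Defs

open import Algebra.Properties.CommutativeSemigroup +-commutativeSemigroup using (x∙yz≈y∙xz)
open import Algebra.Properties.Monoid.Sum +-0-monoid using (sum-syntax; sum-cong-≗; sum-replicate-zero)
open import Data.List.Relation.Binary.Permutation.Setoid.Properties (setoid ℕ) using (AllPairs-resp-↭)
open import Data.List.Relation.Unary.Sorted.TotalOrder ≤-totalOrder using (Sorted)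
open import Data.List.Sort ≤-decTotalOrder using (sort; sort-↭; sort-↗)
open Equivalence using (to; from)
open ≡-Reasoning

indicator : ∀ {p} {P : Set p} → Dec P → ℕ
indicator P? = if does P? then 1 else 0

indicator-⇔ : ∀ {p q} {P : Set p} {Q : Set q} → P ⇔ Q → (P? : Dec P) (Q? : Dec Q) →
  indicator P? ≡ indicator Q?
indicator-⇔ P⇔Q P? Q? = cong (λ b → if b then 1 else 0) (does-⇔ P⇔Q P? Q?)

indicator-no : ∀ {p} {P : Set p} → ¬ P → (P? : Dec P) → indicator P? ≡ 0
indicator-no ¬P P? = cong (λ b → if b then 1 else 0) (dec-false P? ¬P)

length-filter-tabulate : ∀ {a p} {A : Set a} {P : Pred A p} (P? : Decidable P) {n} (f : Fin n → A) →
  length (filter P? (tabulate f)) ≡ ∑[ i < n ] indicator (P? (f i))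
length-filter-tabulate P? {zero}  f = refl
length-filter-tabulate P? {suc n} f with does (P? (f zero))
... | true  = cong suc (length-filter-tabulate P? (f ∘ suc))
... | false = length-filter-tabulate P? (f ∘ suc)

length-filter-cartesianProduct : ∀ {a b p} {A : Set a} {B : Set b} {P : Pred (A × B) p}
  (P? : Decidable P) {m n} (f : Fin m → A) (g : Fin n → B) →
  length (filter P? (cartesianProduct (tabulate f) (tabulate g)))
    ≡ ∑[ i < m ] ∑[ j < n ] indicator (P? (f i , g j))
length-filter-cartesianProduct P? {zero}      f g = refl
length-filter-cartesianProduct {A = A} {B} P? {suc m} {n} f g = begin
  length (filter P? (row ++ rest))                 ≡⟨ cong length (filter-++ P? row rest) ⟩
  length (filter P? row ++ filter P? rest)         ≡⟨ length-++ (filter P? row) ⟩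
  length (filter P? row) + length (filter P? rest)
    ≡⟨ cong₂ _+_ row-count (length-filter-cartesianProduct P? (f ∘ suc) g) ⟩
  ∑[ i < suc m ] ∑[ j < n ] indicator (P? (f i , g j)) ∎
  where
  row : List (A × B)
  row = map (f zero ,_) (tabulate g)
  rest : List (A × B)
  rest = cartesianProduct (tabulate (f ∘ suc)) (tabulate g)
  row-count : length (filter P? row) ≡ ∑[ j < n ] indicator (P? (f zero , g j))
  row-count = trans (cong (length ∘ filter P?) (map-tabulate g (f zero ,_)))
                    (length-filter-tabulate P? ((f zero ,_) ∘ g))

length-filter-allPairs-∷ : ∀ {p q} x xs {P : Pred (Pair (x ∷ xs)) p} {Q : Pred (Pair xs) q}
  (P? : Decidable P) (Q? : Decidable Q) →
  (∀ i → ¬ P (i , zero)) → (∀ i j → P (suc i , suc j) ⇔ Q (i , j)) →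
  length (filter P? (allPairs (x ∷ xs)))
    ≡ ∑[ j < length xs ] indicator (P? (zero , suc j)) + length (filter Q? (allPairs xs))
length-filter-allPairs-∷ x xs P? Q? ¬P[i,0] P⇔Q = begin
  length (filter P? (allPairs (x ∷ xs)))
    ≡⟨ length-filter-cartesianProduct P? id id ⟩
  ∑[ i < suc n ] ∑[ j < suc n ] indicator (P? (i , j))
    ≡⟨ cong₂ _+_ (cong (_+ first-row) (indicator-no (¬P[i,0] zero) (P? (zero , zero))))
                 (sum-cong-≗ λ i → cong₂ _+_
                   (indicator-no (¬P[i,0] (suc i)) (P? (suc i , zero)))
                   (sum-cong-≗ λ j → indicator-⇔ (P⇔Q i j) (P? (suc i , suc j)) (Q? (i , j)))) ⟩
  first-row + ∑[ i < n ] ∑[ j < n ] indicator (Q? (i , j))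
    ≡⟨ cong (first-row +_) (length-filter-cartesianProduct Q? id id) ⟨
  first-row + length (filter Q? (allPairs xs)) ∎
  where
  n : ℕ
  n = length xs
  first-row : ℕ
  first-row = ∑[ j < n ] indicator (P? (zero , suc j))

countBelow : ℕ → List ℕ → ℕ
countBelow v xs = length (filter (_<? v) xs)

countBelow-↭ : ∀ {v xs ys} → xs ↭ ys → countBelow v xs ≡ countBelow v ys
countBelow-↭ {v} p = ↭-length (filter-↭ (_<? v) p)

countBelow-++ : ∀ v xs ys → countBelow v (xs ++ ys) ≡ countBelow v xs + countBelow v ys
countBelow-++ v xs ys = trans (cong length (filter-++ (_<? v) xs ys)) (length-++ (filter (_<? v) xs))

countBelow-≡0 : ∀ {v xs} → All (v ≤_) xs → countBelow v xs ≡ 0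
countBelow-≡0 {v} v≤xs = cong length (filter-none (_<? v) (All.map ≤⇒≯ v≤xs))

countBelow-∷-< : ∀ {v x} xs → x < v → countBelow v (x ∷ xs) ≡ suc (countBelow v xs)
countBelow-∷-< {v} xs x<v = cong length (filter-accept (_<? v) x<v)

sum-indicator≡countBelow : ∀ {p v} xs {P : Pred (Fin (length xs)) p} (P? : Decidable P) →
  (∀ j → P j ⇔ lookup xs j < v) → ∑[ j < length xs ] indicator (P? j) ≡ countBelow v xs
sum-indicator≡countBelow {v = v} xs P? P⇔ = begin
  ∑[ j < length xs ] indicator (P? j)
    ≡⟨ sum-cong-≗ (λ j → indicator-⇔ (P⇔ j) (P? j) (lookup xs j <? v)) ⟩
  ∑[ j < length xs ] indicator (lookup xs j <? v) ≡⟨ length-filter-tabulate (_<? v) (lookup xs) ⟨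
  countBelow v (tabulate (lookup xs))             ≡⟨ cong (countBelow v) (tabulate-lookup xs) ⟩
  countBelow v xs                                 ∎

maxEntries : List Bool → List ℕ → List ℕ
maxEntries (true ∷ bs)  (x ∷ xs) = x ∷ maxEntries bs xs
maxEntries (false ∷ bs) (x ∷ xs) = maxEntries bs xs
maxEntries _ _ = []

↭-maxEntries++nonMaxEntries : ∀ bs xs → length bs ≡ length xs →
  xs ↭ maxEntries bs xs ++ nonMaxEntries bs xs
↭-maxEntries++nonMaxEntries []           []       _   = ↭-refl
↭-maxEntries++nonMaxEntries (true ∷ bs)  (x ∷ xs) len =
  prep x (↭-maxEntries++nonMaxEntries bs xs (suc-injective len))
↭-maxEntries++nonMaxEntries (false ∷ bs) (x ∷ xs) len =
  ↭-trans (prep x (↭-maxEntries++nonMaxEntries bs xs (suc-injective len)))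
          (↭-sym (shift x (maxEntries bs xs) (nonMaxEntries bs xs)))

refill-↭-maxEntries++ : ∀ bs xs ys → length bs ≡ length xs → length ys ≡ length (nonMaxEntries bs xs) →
  refill bs xs ys ↭ maxEntries bs xs ++ ys
refill-↭-maxEntries++ []           []       []       _   _    = ↭-refl
refill-↭-maxEntries++ (true ∷ bs)  (x ∷ xs) ys       len len′ =
  prep x (refill-↭-maxEntries++ bs xs ys (suc-injective len) len′)
refill-↭-maxEntries++ (false ∷ bs) (x ∷ xs) (y ∷ ys) len len′ =
  ↭-trans (prep y (refill-↭-maxEntries++ bs xs ys (suc-injective len) (suc-injective len′)))
          (↭-sym (shift y (maxEntries bs xs) ys))

countBelow-refill : ∀ v bs xs ys → length bs ≡ length xs → length ys ≡ length (nonMaxEntries bs xs) →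
  countBelow v ys ≡ countBelow v (nonMaxEntries bs xs) → countBelow v (refill bs xs ys) ≡ countBelow v xs
countBelow-refill v bs xs ys len len′ ys≈ = begin
  countBelow v (refill bs xs ys)       ≡⟨ countBelow-↭ (refill-↭-maxEntries++ bs xs ys len len′) ⟩
  countBelow v (M ++ ys)               ≡⟨ countBelow-++ v M ys ⟩
  countBelow v M + countBelow v ys     ≡⟨ cong (countBelow v M +_) ys≈ ⟩
  countBelow v M + countBelow v N      ≡⟨ countBelow-++ v M N ⟨
  countBelow v (M ++ N)                ≡⟨ countBelow-↭ (↭-maxEntries++nonMaxEntries bs xs len) ⟨
  countBelow v xs                      ∎
  where
  M N : List ℕ
  M = maxEntries bs xs
  N = nonMaxEntries bs xs

-- The threshold m stands for the maximum of a prefix that has already been read.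
IsLRMaxAbove : ℕ → (σ : List ℕ) → Fin (length σ) → Set
IsLRMaxAbove m σ i = m < at σ i × IsLRMax σ i

lrFlagsAbove : ℕ → List ℕ → List Bool
lrFlagsAbove m []       = []
lrFlagsAbove m (x ∷ xs) with m <? x
... | yes _ = true  ∷ lrFlagsAbove x xs
... | no  _ = false ∷ lrFlagsAbove m xs

length-lrFlagsAbove : ∀ m xs → length (lrFlagsAbove m xs) ≡ length xs
length-lrFlagsAbove m []       = refl
length-lrFlagsAbove m (x ∷ xs) with m <? x
... | yes _ = cong suc (length-lrFlagsAbove x xs)
... | no  _ = cong suc (length-lrFlagsAbove m xs)

maxEntries-lrFlagsAbove : ∀ m xs → All (m <_) (maxEntries (lrFlagsAbove m xs) xs)
maxEntries-lrFlagsAbove m []       = []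
maxEntries-lrFlagsAbove m (x ∷ xs) with m <? x
... | yes m<x = m<x ∷ All.map (<-trans m<x) (maxEntries-lrFlagsAbove x xs)
... | no  _   = maxEntries-lrFlagsAbove m xs

IsLRMaxAbove-∷ : ∀ {m m′ x xs} → (∀ {a} → m′ < a ⇔ (m < a × x < a)) →
  ∀ i → IsLRMaxAbove m (x ∷ xs) (suc i) ⇔ IsLRMaxAbove m′ xs i
IsLRMaxAbove-∷ m′< i = mk⇔
  (λ (m<a , lr) → from m′< (m<a , lr zero z<s) , λ j j<i → lr (suc j) (s<s j<i))
  (λ (m′<a , lr) → proj₁ (to m′< m′<a) ,
     λ { zero _ → proj₂ (to m′< m′<a) ; (suc j) j<i → lr j (s<s⁻¹ j<i) })

tabulate-does≡lrFlagsAbove : ∀ {p} m xs {P : Pred (Fin (length xs)) p} (P? : Decidable P) →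
  (∀ i → P i ⇔ IsLRMaxAbove m xs i) → tabulate (does ∘ P?) ≡ lrFlagsAbove m xs
tabulate-does≡lrFlagsAbove m []       P? P⇔ = refl
tabulate-does≡lrFlagsAbove m (x ∷ xs) P? P⇔ with m <? x
... | yes m<x = cong₂ _∷_ (dec-true (P? zero) (from (P⇔ zero) (m<x , λ _ ())))
  (tabulate-does≡lrFlagsAbove x xs (P? ∘ suc) λ i →
    ⇔.trans (P⇔ (suc i)) (IsLRMaxAbove-∷ (mk⇔ (λ x<a → <-trans m<x x<a , x<a) proj₂) i))
... | no  m≮x = cong₂ _∷_ (dec-false (P? zero) (m≮x ∘ proj₁ ∘ to (P⇔ zero)))
  (tabulate-does≡lrFlagsAbove m xs (P? ∘ suc) λ i →
    ⇔.trans (P⇔ (suc i)) (IsLRMaxAbove-∷ (mk⇔ (λ m<a → m<a , ≤-<-trans (≮⇒≥ m≮x) m<a) proj₁) i))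

lrFlags≡lrFlagsAbove0 : ∀ σ → All (0 <_) σ → lrFlags σ ≡ lrFlagsAbove 0 σ
lrFlags≡lrFlagsAbove0 σ σ>0 = trans (map-tabulate id (does ∘ isLRMax? σ))
  (tabulate-does≡lrFlagsAbove 0 σ (isLRMax? σ) λ i → mk⇔ (All.lookup σ>0 (∈-lookup i) ,_) proj₂)

InvPair-suc : ∀ x xs i j → InvPair (x ∷ xs) (suc i , suc j) ⇔ InvPair xs (i , j)
InvPair-suc x xs i j = mk⇔ (λ (i<j , lt) → s<s⁻¹ i<j , lt) (λ (i<j , lt) → s<s i<j , lt)

inv-∷ : ∀ x xs → inv (x ∷ xs) ≡ countBelow x xs + inv xs
inv-∷ x xs = trans
  (length-filter-allPairs-∷ x xs (invPair? (x ∷ xs)) (invPair? xs) (λ { _ (() , _) }) (InvPair-suc x xs))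
  (cong (_+ inv xs) (sum-indicator≡countBelow xs (λ j → invPair? (x ∷ xs) (zero , suc j))
    λ j → mk⇔ proj₂ (z<s ,_)))

inv-∷-min : ∀ {y τ} → All (y ≤_) τ → inv (y ∷ τ) ≡ inv τ
inv-∷-min {y} {τ} y≤τ = trans (inv-∷ y τ) (cong (_+ inv τ) (countBelow-≡0 y≤τ))

Dominated : ℕ → (σ : List ℕ) → Fin (length σ) → Set
Dominated m σ j = at σ j < m ⊎ ∃ λ i → toℕ i < toℕ j × at σ j < at σ i

dominated? : ∀ m σ → Decidable (Dominated m σ)
dominated? m σ j = (at σ j <? m) ⊎-dec any? (λ i → (toℕ i <? toℕ j) ×-dec (at σ j <? at σ i))

DominatedInversion : ℕ → (σ : List ℕ) → Pair σ → Set
DominatedInversion m σ (j , k) = InvPair σ (j , k) × Dominated m σ j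

dominatedInversion? : ∀ m σ → Decidable (DominatedInversion m σ)
dominatedInversion? m σ (j , k) = invPair? σ (j , k) ×-dec dominated? m σ j

dominatedInversions : ℕ → List ℕ → ℕ
dominatedInversions m σ = length (filter (dominatedInversion? m σ) (allPairs σ))

rhsCount≡dominatedInversions : ∀ σ → rhsCount σ ≡ dominatedInversions 0 σ
rhsCount≡dominatedInversions σ = cong length (filter-≐ (rhsPair? σ) (dominatedInversion? 0 σ)
  ( (λ (j<k , lt , dom) → (j<k , lt) , inj₂ dom)
  , λ { ((j<k , lt) , inj₂ dom) → j<k , lt , dom })
  (allPairs σ))

Dominated-∷ : ∀ {m m′ x xs} → (∀ {a} → a < m′ ⇔ (a < m ⊎ a < x)) →
  ∀ j → Dominated m (x ∷ xs) (suc j) ⇔ Dominated m′ xs j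
Dominated-∷ <m′ j = mk⇔
  (λ { (inj₁ a<m)                  → inj₁ (from <m′ (inj₁ a<m))
     ; (inj₂ (zero , _ , a<x))     → inj₁ (from <m′ (inj₂ a<x))
     ; (inj₂ (suc i , i<j , a<σi)) → inj₂ (i , s<s⁻¹ i<j , a<σi) })
  (λ { (inj₁ a<m′)            → [ inj₁ , (λ a<x → inj₂ (zero , z<s , a<x)) ] (to <m′ a<m′)
     ; (inj₂ (i , i<j , a<σi)) → inj₂ (suc i , s<s i<j , a<σi) })

dominatedInversions-∷-< : ∀ {m x} xs → x < m →
  dominatedInversions m (x ∷ xs) ≡ countBelow x xs + dominatedInversions m xs
dominatedInversions-∷-< {m} {x} xs x<m = trans
  (length-filter-allPairs-∷ x xs (dominatedInversion? m (x ∷ xs)) (dominatedInversion? m xs)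
    (λ { _ ((() , _) , _) })
    λ i j → InvPair-suc x xs i j ×-⇔
              Dominated-∷ {xs = xs} (mk⇔ inj₁ [ id , (λ a<x → <-trans a<x x<m) ]) i)
  (cong (_+ dominatedInversions m xs)
    (sum-indicator≡countBelow xs (λ j → dominatedInversion? m (x ∷ xs) (zero , suc j))
      λ j → mk⇔ (proj₂ ∘ proj₁) (λ a<x → (z<s , a<x) , inj₁ x<m)))

dominatedInversions-∷-≥ : ∀ {m x} xs → m ≤ x → dominatedInversions m (x ∷ xs) ≡ dominatedInversions x xs
dominatedInversions-∷-≥ {m} {x} xs m≤x = trans
  (length-filter-allPairs-∷ x xs (dominatedInversion? m (x ∷ xs)) (dominatedInversion? x xs)
    (λ { _ ((() , _) , _) })
    λ i j → InvPair-suc x xs i j ×-⇔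
              Dominated-∷ {xs = xs} (mk⇔ inj₂ [ (λ a<m → <-≤-trans a<m m≤x) , id ]) i)
  (cong (_+ dominatedInversions x xs)
    (trans (sum-cong-≗ λ j →
             indicator-no (x-undominated ∘ proj₂) (dominatedInversion? m (x ∷ xs) (zero , suc j)))
           (sum-replicate-zero (length xs))))
  where
  x-undominated : ¬ Dominated m (x ∷ xs) zero
  x-undominated (inj₁ x<m)          = <⇒≱ x<m m≤x
  x-undominated (inj₂ (_ , () , _))

-- Equivalently: the same entries above m, and equally many entries ≤ m.
AgreeAbove : ℕ → List ℕ → List ℕ → Set
AgreeAbove m xs ys = ∀ v → m < v → countBelow v xs ≡ countBelow v ys

AgreeAbove⇒head≤ : ∀ {m x y xs ys} → Sorted (y ∷ ys) → x ≤ m → AgreeAbove m (y ∷ ys) (x ∷ xs) → y ≤ m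
AgreeAbove⇒head≤ {m} {x} {y} {xs} {ys} y∷ys↗ x≤m agree = ≮⇒≥ λ m<y → 0≢1+n (begin
  0                           ≡⟨ countBelow-≡0 (Linked⇒All ≤-trans m<y y∷ys↗) ⟨
  countBelow (suc m) (y ∷ ys) ≡⟨ agree (suc m) ≤-refl ⟩
  countBelow (suc m) (x ∷ xs) ≡⟨ countBelow-∷-< xs (s≤s x≤m) ⟩
  suc (countBelow (suc m) xs) ∎)

AgreeAbove-∷ : ∀ {m x y xs ys} → y ≤ m → x ≤ m → AgreeAbove m (y ∷ ys) (x ∷ xs) → AgreeAbove m ys xs
AgreeAbove-∷ {x = x} {y} {xs} {ys} y≤m x≤m agree v m<v = suc-injective (begin
  suc (countBelow v ys) ≡⟨ countBelow-∷-< ys (≤-<-trans y≤m m<v) ⟨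
  countBelow v (y ∷ ys) ≡⟨ agree v m<v ⟩
  countBelow v (x ∷ xs) ≡⟨ countBelow-∷-< xs (≤-<-trans x≤m m<v) ⟩
  suc (countBelow v xs) ∎)

-- An entry equal to m would be neither a left-to-right maximum above m nor dominated.
inv-refill : ∀ m s ys → Unique (m ∷ s) → Sorted ys →
  length ys ≡ length (nonMaxEntries (lrFlagsAbove m s) s) →
  AgreeAbove m ys (nonMaxEntries (lrFlagsAbove m s) s) →
  inv s ≡ inv (refill (lrFlagsAbove m s) s ys) + dominatedInversions m s
inv-refill m [] ys _ _ _ _ = refl
inv-refill m (x ∷ xs) ys ((m≢x ∷ m∉xs) ∷ x∉xs ∷ distinct) ys↗ len agree with m <? x
... | yes m<x = begin
  inv (x ∷ xs)                                         ≡⟨ inv-∷ x xs ⟩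
  countBelow x xs + inv xs                             ≡⟨ cong₂ _+_ below-x ih ⟩
  countBelow x τ + (inv τ + dominatedInversions x xs)  ≡⟨ +-assoc (countBelow x τ) _ _ ⟨
  countBelow x τ + inv τ + dominatedInversions x xs
    ≡⟨ cong₂ _+_ (inv-∷ x τ) (dominatedInversions-∷-≥ xs (<⇒≤ m<x)) ⟨
  inv (x ∷ τ) + dominatedInversions m (x ∷ xs)         ∎
  where
  τ : List ℕ
  τ = refill (lrFlagsAbove x xs) xs ys
  ih : inv xs ≡ inv τ + dominatedInversions x xs
  ih = inv-refill x xs ys (x∉xs ∷ distinct) ys↗ len (λ v x<v → agree v (<-trans m<x x<v))
  below-x : countBelow x xs ≡ countBelow x τ
  below-x = sym (countBelow-refill x (lrFlagsAbove x xs) xs ys (length-lrFlagsAbove x xs) len (agree x m<x))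
inv-refill m (x ∷ xs) (y ∷ ys) ((m≢x ∷ m∉xs) ∷ x∉xs ∷ distinct) y∷ys↗ len agree | no m≮x = begin
  inv (x ∷ xs)                                           ≡⟨ inv-∷ x xs ⟩
  countBelow x xs + inv xs                               ≡⟨ cong (countBelow x xs +_) ih ⟩
  countBelow x xs + (inv τ + dominatedInversions m xs)   ≡⟨ x∙yz≈y∙xz (countBelow x xs) (inv τ) _ ⟩
  inv τ + (countBelow x xs + dominatedInversions m xs)
    ≡⟨ cong₂ _+_ (inv-∷-min y≤τ) (dominatedInversions-∷-< xs x<m) ⟨
  inv (y ∷ τ) + dominatedInversions m (x ∷ xs)           ∎
  where
  x<m : x < m
  x<m = ≤∧≢⇒< (≮⇒≥ m≮x) (≢-sym m≢x)
  y≤m : y ≤ m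
  y≤m = AgreeAbove⇒head≤ y∷ys↗ (<⇒≤ x<m) agree
  τ : List ℕ
  τ = refill (lrFlagsAbove m xs) xs ys
  ih : inv xs ≡ inv τ + dominatedInversions m xs
  ih = inv-refill m xs ys (m∉xs ∷ distinct) (Linked.tail y∷ys↗) (suc-injective len)
                  (AgreeAbove-∷ y≤m (<⇒≤ x<m) agree)
  y≤τ : All (y ≤_) τ
  y≤τ = All-resp-↭
    (↭-sym (refill-↭-maxEntries++ (lrFlagsAbove m xs) xs ys (length-lrFlagsAbove m xs) (suc-injective len)))
    (++⁺ (All.map (λ m<a → ≤-trans y≤m (<⇒≤ m<a)) (maxEntries-lrFlagsAbove m xs))
         (All.tail (Linked⇒All ≤-trans ≤-refl y∷ys↗)))

IsPerm⇒Unique[0∷σ] : ∀ {n σ} → IsPerm n σ → Unique (0 ∷ σ)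
IsPerm⇒Unique[0∷σ] {n} σ↭ = AllPairs-resp-↭ ≢-sym (resp₂ _) (↭⇒↭ₛ (↭-sym (prep 0 σ↭)))
  (subst Unique (cong (0 ∷_) (sym (map-upTo suc n))) (upTo⁺ (suc n)))

proposition3p11 : (n : ℕ) (σ : List ℕ) → IsPerm n σ →
    inv σ ≡ inv (Φ321 σ) + rhsCount σ
proposition3p11 n σ σ↭ = begin
  inv σ
    ≡⟨ inv-refill 0 σ ys distinct (sort-↗ NM) (↭-length (sort-↭ NM))
                  (λ _ _ → countBelow-↭ (sort-↭ NM)) ⟩
  inv (refill F σ ys) + dominatedInversions 0 σ
    ≡⟨ cong₂ _+_ (cong inv Φ321≡) (rhsCount≡dominatedInversions σ) ⟨
  inv (Φ321 σ) + rhsCount σ ∎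
  where
  distinct : Unique (0 ∷ σ)
  distinct = IsPerm⇒Unique[0∷σ] σ↭
  F : List Bool
  F = lrFlagsAbove 0 σ
  NM ys : List ℕ
  NM = nonMaxEntries F σ
  ys = sort NM
  Φ321≡ : Φ321 σ ≡ refill F σ ys
  Φ321≡ = cong (λ bs → refill bs σ (sort (nonMaxEntries bs σ)))
    (lrFlags≡lrFlagsAbove0 σ (All.map (n≢0⇒n>0 ∘ ≢-sym) (AllPairs.head distinct)))
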